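{- Let $(\mathscr{L},\vdash)$ be a finitary logical structure such that $\vdash$ satisfies monotonicity and transitivity. If there exists a nonempty finite $\vdash$-trivial set, then every $\vdash$-trivial subset of $\mathscr{L}$ contains a finite $\vdash$-trivial subset.
   Context: A logical structure is a pair $(\mathscr{L},\vdash)$ with $\mathscr{L}$ a set and $\vdash\,\subseteq\mathcal{P}(\mathscr{L})\times\mathscr{L}$. It is finitary if $\Gamma\vdash\alpha$ implies $\Gamma_0\vdash\alpha$ for some finite $\Gamma_0\subseteq\Gamma$. Monotonicity: $\Gamma\vdash\alpha$ and $\Gamma\subseteq\Sigma$ imply $\Sigma\vdash\alpha$. Transitivity: if $\Sigma\vdash\alpha$ and $\Gamma\vdash\beta$ for all $\beta\in\Sigma$, then $\Gamma\vdash\alpha$. A set $\Gamma\subseteq\mathscr{L}$ is $\vdash$-trivial if $\Gamma\vdash\beta$ for every $\beta\in\mathscr{L}$. -}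

module Defs where

open import Level using (Level; suc; _⊔_)
open import Data.List using (List; [])
open import Data.List.Membership.Propositional using (_∈_)
open import Data.Product using (Σ; ∃; _×_; _,_)
open import Relation.Binary.PropositionalEquality using (_≢_)

Subset : Set → Set₁
Subset L = L → Set

_⊆_ : {L : Set} → Subset L → Subset L → Set
Γ ⊆ Σ' = ∀ {x} → Γ x → Σ' x

Rel⊢ : Set → Set₁
Rel⊢ L = Subset L → L → Set

fin : {L : Set} → List L → Subset L
fin xs = λ x → x ∈ xs

Finitary : {L : Set} → Rel⊢ L → Set₁
Finitary {L} _⊢_ = ∀ (Γ : Subset L) (α : L) → Γ ⊢ α →
  Σ (List L) (λ xs → (fin xs ⊆ Γ) × (fin xs ⊢ α))

Monotone : {L : Set} → Rel⊢ L → Set₁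
Monotone {L} _⊢_ = ∀ (Γ Σ' : Subset L) (α : L) → Γ ⊢ α → Γ ⊆ Σ' → Σ' ⊢ α

Transitive : {L : Set} → Rel⊢ L → Set₁
Transitive {L} _⊢_ = ∀ (Γ Σ' : Subset L) (α : L) →
  Σ' ⊢ α → (∀ β → Σ' β → Γ ⊢ β) → Γ ⊢ α

Trivial : {L : Set} → Rel⊢ L → Subset L → Set
Trivial {L} _⊢_ Γ = ∀ (β : L) → Γ ⊢ β

{-# OPTIONS --safe #-}
-- Every element of a finite trivial set Δ is derivable from the trivial set Γ,
-- hence by finitarity from a finite part of Γ. The union Γ₀ of these finitely
-- many parts derives all of Δ by monotonicity, so Γ₀ is trivial by
-- transitivity.
module Submission where

open import Defs
open import Data.List using (List; []; _∷_; _++_)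
open import Data.List.Membership.Propositional.Properties using (∈-++⁺ˡ; ∈-++⁺ʳ; ∈-++⁻)
open import Data.List.Relation.Unary.Any using (here; there)
open import Data.Product using (Σ; _×_; _,_)
open import Data.Sum using ([_,_])
open import Relation.Binary.PropositionalEquality using (_≢_; refl)

fin-++-⊆ : {L : Set} {Γ : Subset L} (xs ys : List L) →
           fin xs ⊆ Γ → fin ys ⊆ Γ → fin (xs ++ ys) ⊆ Γ
fin-++-⊆ xs ys xs⊆Γ ys⊆Γ p = [ xs⊆Γ , ys⊆Γ ] (∈-++⁻ xs p)

module _ {L : Set} {_⊢_ : Rel⊢ L} where

  finite-support : Finitary _⊢_ → Monotone _⊢_ →
                   (Γ : Subset L) (xs : List L) → (∀ x → fin xs x → Γ ⊢ x) →
                   Σ (List L) (λ ys → (fin ys ⊆ Γ) × (∀ x → fin xs x → fin ys ⊢ x))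
  finite-support fi mo Γ [] _ = [] , (λ ()) , (λ _ ())
  finite-support fi mo Γ (x ∷ xs) Γ⊢x∷xs
    with fi Γ x (Γ⊢x∷xs x (here refl))
       | finite-support fi mo Γ xs (λ y p → Γ⊢x∷xs y (there p))
  ... | zs , zs⊆Γ , zs⊢x | ys , ys⊆Γ , ys⊢xs =
    zs ++ ys , fin-++-⊆ zs ys zs⊆Γ ys⊆Γ , derives
    where
    derives : ∀ y → fin (x ∷ xs) y → fin (zs ++ ys) ⊢ y
    derives y (here refl) = mo (fin zs) (fin (zs ++ ys)) y zs⊢x ∈-++⁺ˡ
    derives y (there p)   = mo (fin ys) (fin (zs ++ ys)) y (ys⊢xs y p) (∈-++⁺ʳ zs)

  Trivial-if-derives-trivial : Transitive _⊢_ → (Γ Δ : Subset L) →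
                               Trivial _⊢_ Δ → (∀ β → Δ β → Γ ⊢ β) → Trivial _⊢_ Γ
  Trivial-if-derives-trivial tr Γ Δ Δ-trivial Γ⊢Δ β = tr Γ Δ β (Δ-trivial β) Γ⊢Δ

theorem3p18 : (L : Set) (_⊢_ : Rel⊢ L) →
    Finitary _⊢_ → Monotone _⊢_ → Transitive _⊢_ →
    Σ (List L) (λ xs → (xs ≢ []) × Trivial _⊢_ (fin xs)) →
    (Γ : Subset L) → Trivial _⊢_ Γ →
    Σ (List L) (λ ys → (fin ys ⊆ Γ) × Trivial _⊢_ (fin ys))
theorem3p18 L _⊢_ fi mo tr (xs , _ , xs-trivial) Γ Γ-trivial
  with finite-support fi mo Γ xs (λ x _ → Γ-trivial x)
... | ys , ys⊆Γ , ys⊢xs =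
  ys , ys⊆Γ , Trivial-if-derives-trivial tr (fin ys) (fin xs) xs-trivial ys⊢xs
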